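{- Let $A$ be a type and $f,g:A\to\mathbb{B}$. Then for all $l:\mathsf{colist}\,A$, $\mathsf{filter}\,f\,(\mathsf{filter}\,g\,l)=\mathsf{filter}\,g\,(\mathsf{filter}\,f\,l)$.
   Context: $\mathsf{colist}\,A$ is the coinductive type with constructors $\bot$ and $\mathsf{cocons}\,a\,l$, ordered coinductively by $\bot\sqsubseteq l$ and $\mathsf{cocons}\,a\,l_1\sqsubseteq\mathsf{cocons}\,a\,l_2$ if $l_1\sqsubseteq l_2$; order-equivalent streams are assumed equal (axiom). Lists are ordered by prefix. $\mathsf{idl}\,s\,0=\mathsf{nil}$, $\mathsf{idl}\,\bot\,(i+1)=\mathsf{nil}$, $\mathsf{idl}(\mathsf{cocons}\,a\,s)(i+1)=\mathsf{cons}\,a\,(\mathsf{idl}\,s\,i)$. For monotone $h:\mathsf{list}\,A\to C$, $\overline h(s):=\sup_i h(\mathsf{idl}\,s\,i)$ (chosen supremum). $\mathsf{fold}\,z\,h$: $\mathsf{nil}\mapsto z$, $\mathsf{cons}\,a\,l\mapsto h\,a\,(\mathsf{fold}\,z\,h\,l)$. $\mathsf{filter}\,f:=\overline{\mathsf{fold}\,\bot\,(\lambda a\,l.\,\text{if }f\,a\text{ then }\mathsf{cocons}\,a\,l\text{ else }l)}:\mathsf{colist}\,A\to\mathsf{colist}\,A$. -}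

module Defs where

open import Data.Nat using (ℕ; zero; suc)
open import Data.Bool using (Bool; if_then_else_)
open import Data.Maybe using (Maybe; just; nothing)
open import Data.List using (List; []; _∷_)
open import Relation.Binary.PropositionalEquality using (_≡_; refl)

-- Colists (the final coalgebra of X ↦ 1 + A × X), encoded without
-- coinductive types: a colist is a
-- sequence of optional elements such that once the sequence has ended
-- (nothing = ⊥ reached) it stays ended.  at s n = just a means the n-th
-- element exists and is a.
record Colist (A : Set) : Set where
  field
    at     : ℕ → Maybe A
    closed : ∀ n → at n ≡ nothing → at (suc n) ≡ nothing

open Colist public

⊥c : {A : Set} → Colist A
at ⊥c _ = nothing
closed ⊥c _ _ = refl

cocons : {A : Set} → A → Colist A → Colist A
at (cocons a l) zero    = just a
at (cocons a l) (suc n) = at l n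
closed (cocons a l) zero    ()
closed (cocons a l) (suc n) e = closed l n e

tl : {A : Set} → Colist A → Colist A
at (tl s) n = at s (suc n)
closed (tl s) n e = closed s (suc n) e

-- The coinductive order (⊥ ⊑ l; cocons a l₁ ⊑ cocons a l₂ if l₁ ⊑ l₂),
-- unfolded on this encoding: s is a (possibly infinite) prefix of t.
_⊑_ : {A : Set} → Colist A → Colist A → Set
s ⊑ t = ∀ n a → at s n ≡ just a → at t n ≡ just a

-- Axiom of the paper: order-equivalent colists are equal (taken as a hypothesis).
OrderExt : Set → Set
OrderExt A = ∀ (s t : Colist A) → s ⊑ t → t ⊑ s → s ≡ t

Chain : {A : Set} → (ℕ → Colist A) → Set
Chain c = ∀ i → c i ⊑ c (suc i)

record SupOp (A : Set) : Set where
  field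
    sup   : (ℕ → Colist A) → Colist A
    upper : ∀ c → Chain c → ∀ i → c i ⊑ sup c
    least : ∀ c → Chain c → ∀ u → (∀ i → c i ⊑ u) → sup c ⊑ u

open SupOp public

idl : {A : Set} → Colist A → ℕ → List A
idl s zero = []
idl s (suc i) with at s zero
... | nothing = []
... | just a  = a ∷ idl (tl s) i

lift : {A B : Set} → SupOp B → (List A → Colist B) → Colist A → Colist B
lift S h s = sup S (λ i → h (idl s i))

fold : {A C : Set} → C → (A → C → C) → List A → C
fold z h []       = z
fold z h (a ∷ l)  = h a (fold z h l)

filter : {A : Set} → SupOp A → (A → Bool) → Colist A → Colist A
filter S f = lift S (fold ⊥c (λ a l → if f a then cocons a l else l))

-- Filtering a colist is Scott-continuous: filter f (sup c) = sup (filter f ∘ c)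
-- for every ascending chain c.  Hence filter f (filter g l), which is
-- filter f applied to the sup of the finite filterings of the prefixes of l,
-- is the sup of filter f (filterList g (idl l i)), and on those finite
-- colists the two filters visibly commute.
--
-- Continuity reduces to showing that each finite prefix of sup c is filtered
-- below sup (filter f ∘ c), by induction on the prefix.  If sup c starts
-- with a, then every c i is ⊥c or starts with a; when f a holds, sup
-- (filter f ∘ c) must then start with a as well, for otherwise every c i,
-- and so sup c, would be ⊥c.
module Submission where

open import Data.Bool using (Bool; true; false; if_then_else_)
open import Data.Empty using (⊥-elim)
open import Data.List using (List; []; _∷_)
open import Data.List.Relation.Binary.Prefix.Heterogeneous using (Prefix; []; _∷_)
open import Data.Maybe using (just; nothing)
open import Data.Maybe.Properties using (just-injective)
open import Data.Nat using (ℕ; zero; suc)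
open import Function using (_∘_)
open import Relation.Binary.PropositionalEquality
open import Relation.Nullary using (¬_)

open import Defs

module _ {A : Set} where

  -- ⊑ wrapped in a record, so that its arguments can be inferred from its type
  record _≤_ (s t : Colist A) : Set where
    constructor ≤⁺
    field ≤⁻ : s ⊑ t
  open _≤_

  variable
    a b : A
    s t u v : Colist A
    c d : ℕ → Colist A
    f g : A → Bool

  ≤-refl : s ≤ s
  ≤-refl = ≤⁺ λ _ _ e → e

  ≤-reflexive : s ≡ t → s ≤ t
  ≤-reflexive refl = ≤-refl

  ≤-trans : s ≤ t → t ≤ u → s ≤ u
  ≤-trans p q = ≤⁺ λ n a e → ≤⁻ q n a (≤⁻ p n a e)

  ⊥c-least : ⊥c ≤ s
  ⊥c-least = ≤⁺ λ _ _ ()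

  cocons≰⊥c : ¬ (cocons a s ≤ ⊥c)
  cocons≰⊥c p with ≤⁻ p zero _ refl
  ... | ()

  cocons-mono : s ≤ t → cocons a s ≤ cocons a t
  cocons-mono p = ≤⁺ λ { zero _ e → e ; (suc n) → ≤⁻ p n }

  tl-mono : s ≤ t → tl s ≤ tl t
  tl-mono p = ≤⁺ (≤⁻ p ∘ suc)

  cocons-head-unique : cocons a s ≤ u → cocons b t ≤ u → a ≡ b
  cocons-head-unique p q = just-injective (trans (sym (≤⁻ p zero _ refl)) (≤⁻ q zero _ refl))

  cocons-≤ : cocons a t ≤ u → v ≤ tl u → cocons a v ≤ u
  cocons-≤ p q = ≤⁺ λ { zero → ≤⁻ p zero ; (suc n) → ≤⁻ q n }

  ≤-⊥c : at s zero ≡ nothing → s ≤ ⊥c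
  ≤-⊥c {s} e = ≤⁺ λ n _ e′ → trans (sym (ended n)) e′
    where
    ended : ∀ n → at s n ≡ nothing
    ended zero    = e
    ended (suc n) = closed s n (ended n)

  data Uncons : Colist A → Set where
    is-⊥c     : Uncons ⊥c
    is-cocons : ∀ a s → Uncons (cocons a s)

  data ⊥OrCocons (a : A) : Colist A → Set where
    is-⊥c     : ⊥OrCocons a ⊥c
    is-cocons : ∀ s → ⊥OrCocons a (cocons a s)

  ≤-cocons : ⊥OrCocons a s → tl s ≤ v → s ≤ cocons a v
  ≤-cocons is-⊥c         _ = ⊥c-least
  ≤-cocons (is-cocons s) p = cocons-mono p

  ⊥OrCocons-≰⊥c : ⊥OrCocons a u → ¬ (u ≤ ⊥c) → cocons a (tl u) ≤ u
  ⊥OrCocons-≰⊥c is-⊥c         u≰⊥c = ⊥-elim (u≰⊥c ≤-refl)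
  ⊥OrCocons-≰⊥c (is-cocons s) _    = ≤-refl

  Ascending : (ℕ → Colist A) → Set
  Ascending c = ∀ i → c i ≤ c (suc i)

  consIf : (A → Bool) → A → Colist A → Colist A
  consIf f a s = if f a then cocons a s else s

  consIf-mono : s ≤ t → consIf f a s ≤ consIf f a t
  consIf-mono {f = f} {a = a} p with f a
  ... | true  = cocons-mono p
  ... | false = p

  filterList : (A → Bool) → List A → Colist A
  filterList f = fold ⊥c (consIf f)

  filterList-mono : ∀ {l m} → Prefix _≡_ l m → filterList f l ≤ filterList f m
  filterList-mono         []         = ⊥c-least
  filterList-mono {f = f} (refl ∷ p) = consIf-mono {f = f} (filterList-mono p)

  module _ (ext : OrderExt A) where

    ≤-antisym : s ≤ t → t ≤ s → s ≡ t
    ≤-antisym p q = ext _ _ (≤⁻ p) (≤⁻ q)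

    -- a colist is a function, so it is literally ⊥c or a cocons only up to OrderExt
    uncons : (s : Colist A) → Uncons s
    uncons s with at s zero in e
    ... | nothing = subst Uncons (≤-antisym ⊥c-least (≤-⊥c e)) is-⊥c
    ... | just a  = subst Uncons (≤-antisym (≤⁺ λ { zero _ e′ → trans e e′ ; (suc n) _ e′ → e′ })
                                            (≤⁺ λ { zero _ e′ → trans (sym e) e′ ; (suc n) _ e′ → e′ }))
                                 (is-cocons a (tl s))

    ⊥OrCocons-below : cocons a t ≤ u → s ≤ u → ⊥OrCocons a s
    ⊥OrCocons-below {s = s} p q with uncons s
    ... | is-⊥c         = is-⊥c
    ... | is-cocons b s′ with cocons-head-unique p q
    ...   | refl = is-cocons s′

    idl-ascending : ∀ i → Prefix _≡_ (idl s i) (idl s (suc i))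
    idl-ascending         zero    = []
    idl-ascending {s = s} (suc i) with uncons s
    ... | is-⊥c         = []
    ... | is-cocons a s′ = refl ∷ idl-ascending i

    idl-mono : ∀ i → s ≤ t → Prefix _≡_ (idl s i) (idl t i)
    idl-mono                 zero    _ = []
    idl-mono {s = s} {t = t} (suc i) p with uncons s | uncons t
    ... | is-⊥c         | _              = []
    ... | is-cocons a s′ | is-⊥c          = ⊥-elim (cocons≰⊥c p)
    ... | is-cocons a s′ | is-cocons b t′ with cocons-head-unique p ≤-refl
    ...   | refl = refl ∷ idl-mono i (tl-mono p)

    filterList-idl-ascending : ∀ f s → Ascending (λ i → filterList f (idl s i))
    filterList-idl-ascending f s = filterList-mono ∘ idl-ascending

    module _ (S : SupOp A) where

      sup-upper : Ascending c → ∀ i → c i ≤ sup S c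
      sup-upper ch i = ≤⁺ (upper S _ (≤⁻ ∘ ch) i)

      sup-least : Ascending c → (∀ i → c i ≤ u) → sup S c ≤ u
      sup-least {u = u} ch p = ≤⁺ (least S _ (≤⁻ ∘ ch) u (≤⁻ ∘ p))

      sup-cong : Ascending c → (∀ i → c i ≡ d i) → sup S c ≡ sup S d
      sup-cong {c = c} {d = d} ch p =
        ≤-antisym (sup-least ch λ i → ≤-trans (≤-reflexive (p i)) (sup-upper chd i))
                  (sup-least chd λ i → ≤-trans (≤-reflexive (sym (p i))) (sup-upper ch i))
        where
        chd : Ascending d
        chd i = ≤-trans (≤-reflexive (sym (p i))) (≤-trans (ch i) (≤-reflexive (p (suc i))))

      sup-suc : Ascending c → sup S (c ∘ suc) ≡ sup S c
      sup-suc ch = ≤-antisym (sup-least (ch ∘ suc) (sup-upper ch ∘ suc))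
                             (sup-least ch λ i → ≤-trans (ch i) (sup-upper (ch ∘ suc) i))

      sup-cocons : Ascending c → sup S (cocons a ∘ c) ≡ cocons a (sup S c)
      sup-cocons ch = ≤-antisym
        (sup-least (cocons-mono ∘ ch) (cocons-mono ∘ sup-upper ch))
        (cocons-≤ (sup-upper (cocons-mono ∘ ch) zero)
                  (sup-least ch (tl-mono ∘ sup-upper (cocons-mono ∘ ch))))

      sup-⊥OrCocons : Ascending c → (∀ i → ⊥OrCocons a (c i)) → ⊥OrCocons a (sup S c)
      sup-⊥OrCocons ch p =
        ⊥OrCocons-below ≤-refl (sup-least ch λ i → ≤-cocons (p i) (tl-mono (sup-upper ch i)))

      cocons-≤-sup : Ascending c → cocons a t ≤ sup S c → t ≤ sup S (tl ∘ c)
      cocons-≤-sup ch p = tl-mono (≤-trans p (sup-least ch λ i →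
        ≤-cocons (⊥OrCocons-below p (sup-upper ch i)) (sup-upper (tl-mono ∘ ch) i)))

      filter-upper : ∀ i → filterList f (idl s i) ≤ filter S f s
      filter-upper = sup-upper (filterList-idl-ascending _ _)

      filter-least : (∀ i → filterList f (idl s i) ≤ u) → filter S f s ≤ u
      filter-least = sup-least (filterList-idl-ascending _ _)

      filter-mono : s ≤ t → filter S f s ≤ filter S f t
      filter-mono p = filter-least λ i → ≤-trans (filterList-mono (idl-mono i p)) (filter-upper i)

      filter-⊥c : filter S f ⊥c ≡ ⊥c
      filter-⊥c = ≤-antisym (filter-least λ { zero → ⊥c-least ; (suc i) → ⊥c-least }) ⊥c-least

      filter-cocons-true : f a ≡ true → filter S f (cocons a s) ≡ cocons a (filter S f s)
      filter-cocons-true {f} {a} {s} fa = begin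
        filter S f (cocons a s)                           ≡⟨ sym (sup-suc (filterList-idl-ascending f (cocons a s))) ⟩
        sup S (λ i → filterList f (a ∷ idl s i))          ≡⟨ sup-cong (filterList-idl-ascending f (cocons a s) ∘ suc) cons-true ⟩
        sup S (λ i → cocons a (filterList f (idl s i)))   ≡⟨ sup-cocons (filterList-idl-ascending f s) ⟩
        cocons a (filter S f s)                           ∎
        where
        open ≡-Reasoning
        cons-true : ∀ i → filterList f (a ∷ idl s i) ≡ cocons a (filterList f (idl s i))
        cons-true i rewrite fa = refl

      filter-cocons-false : f a ≡ false → filter S f (cocons a s) ≡ filter S f s
      filter-cocons-false {f} {a} {s} fa = begin
        filter S f (cocons a s)                     ≡⟨ sym (sup-suc (filterList-idl-ascending f (cocons a s))) ⟩
        sup S (λ i → filterList f (a ∷ idl s i))    ≡⟨ sup-cong (filterList-idl-ascending f (cocons a s) ∘ suc) cons-false ⟩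
        filter S f s                                ∎
        where
        open ≡-Reasoning
        cons-false : ∀ i → filterList f (a ∷ idl s i) ≡ filterList f (idl s i)
        cons-false i rewrite fa = refl

      filter-⊥OrCocons : f a ≡ true → ⊥OrCocons a s → ⊥OrCocons a (filter S f s)
      filter-⊥OrCocons fa is-⊥c         = subst (⊥OrCocons _) (sym filter-⊥c) is-⊥c
      filter-⊥OrCocons fa (is-cocons s) = subst (⊥OrCocons _) (sym (filter-cocons-true fa)) (is-cocons _)

      filter-≤⊥c : f a ≡ true → ⊥OrCocons a s → filter S f s ≤ ⊥c → s ≤ ⊥c
      filter-≤⊥c fa is-⊥c         _ = ≤-refl
      filter-≤⊥c fa (is-cocons s) p = ⊥-elim (cocons≰⊥c (≤-trans (≤-reflexive (sym (filter-cocons-true fa))) p))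

      filter-tl-true : f a ≡ true → ⊥OrCocons a s → filter S f (tl s) ≤ tl (filter S f s)
      filter-tl-true fa is-⊥c         = ≤-trans (≤-reflexive filter-⊥c) ⊥c-least
      filter-tl-true fa (is-cocons s) = tl-mono (≤-reflexive (sym (filter-cocons-true fa)))

      filter-tl-false : f a ≡ false → ⊥OrCocons a s → filter S f (tl s) ≤ filter S f s
      filter-tl-false fa is-⊥c         = ≤-refl
      filter-tl-false fa (is-cocons s) = ≤-reflexive (sym (filter-cocons-false fa))

      module _ {f : A → Bool} (ch : Ascending c) (a≤sup : cocons a t ≤ sup S c) where

        private
          starts : ∀ i → ⊥OrCocons a (c i)
          starts i = ⊥OrCocons-below a≤sup (sup-upper ch i)

          filter-ch : Ascending (filter S f ∘ c)
          filter-ch = filter-mono ∘ ch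

          filter-tl-ch : Ascending (filter S f ∘ tl ∘ c)
          filter-tl-ch = filter-mono ∘ tl-mono ∘ ch

        sup-filter-tl-≤-false : f a ≡ false → sup S (filter S f ∘ tl ∘ c) ≤ sup S (filter S f ∘ c)
        sup-filter-tl-≤-false fa =
          sup-least filter-tl-ch λ i → ≤-trans (filter-tl-false fa (starts i)) (sup-upper filter-ch i)

        sup-filter-tl-≤-true : f a ≡ true → cocons a (sup S (filter S f ∘ tl ∘ c)) ≤ sup S (filter S f ∘ c)
        sup-filter-tl-≤-true fa = cocons-≤ (⊥OrCocons-≰⊥c sup-starts sup≰⊥c) tail-≤
          where
          sup-starts : ⊥OrCocons a (sup S (filter S f ∘ c))
          sup-starts = sup-⊥OrCocons filter-ch (filter-⊥OrCocons fa ∘ starts)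
          sup≰⊥c : ¬ (sup S (filter S f ∘ c) ≤ ⊥c)
          sup≰⊥c q = cocons≰⊥c (≤-trans a≤sup (sup-least ch λ i →
            filter-≤⊥c fa (starts i) (≤-trans (sup-upper filter-ch i) q)))
          tail-≤ : sup S (filter S f ∘ tl ∘ c) ≤ tl (sup S (filter S f ∘ c))
          tail-≤ = sup-least filter-tl-ch λ i →
            ≤-trans (filter-tl-true fa (starts i)) (tl-mono (sup-upper filter-ch i))

        consIf-sup-filter-tl-≤ : consIf f a (sup S (filter S f ∘ tl ∘ c)) ≤ sup S (filter S f ∘ c)
        consIf-sup-filter-tl-≤ with f a in fa
        ... | true  = sup-filter-tl-≤-true fa
        ... | false = sup-filter-tl-≤-false fa

      filterList-idl-≤ : ∀ k → Ascending c → s ≤ sup S c → filterList f (idl s k) ≤ sup S (filter S f ∘ c)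
      filterList-idl-≤                 zero    _  _ = ⊥c-least
      filterList-idl-≤ {s = s} {f = f} (suc k) ch p with uncons s
      ... | is-⊥c        = ⊥c-least
      ... | is-cocons a t = ≤-trans (consIf-mono {f = f} (filterList-idl-≤ k (tl-mono ∘ ch) (cocons-≤-sup ch p)))
                                    (consIf-sup-filter-tl-≤ ch p)

      filter-sup : Ascending c → filter S f (sup S c) ≡ sup S (filter S f ∘ c)
      filter-sup ch = ≤-antisym (filter-least λ k → filterList-idl-≤ k ch ≤-refl)
                                (sup-least (filter-mono ∘ ch) (filter-mono ∘ sup-upper ch))

      filter-filterList-comm : ∀ l → filter S f (filterList g l) ≡ filter S g (filterList f l)
      filter-filterList-comm [] = trans filter-⊥c (sym filter-⊥c)
      filter-filterList-comm {f} {g} (a ∷ l) with f a in fa | g a in ga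
      ... | true  | true  = trans (filter-cocons-true fa)
                                  (trans (cong (cocons a) (filter-filterList-comm l)) (sym (filter-cocons-true ga)))
      ... | true  | false = trans (filter-filterList-comm l) (sym (filter-cocons-false ga))
      ... | false | true  = trans (filter-cocons-false fa) (filter-filterList-comm l)
      ... | false | false = filter-filterList-comm l

mainTheorem10 : {A : Set} → OrderExt A → (S : SupOp A) → (f g : A → Bool) →
    (l : Colist A) → filter S f (filter S g l) ≡ filter S g (filter S f l)
mainTheorem10 ext S f g l = begin
  filter S f (filter S g l)                          ≡⟨ filter-sup ext S (filterList-idl-ascending ext g l) ⟩
  sup S (λ i → filter S f (filterList g (idl l i)))  ≡⟨ sup-cong ext S (filter-mono ext S ∘ filterList-idl-ascending ext g l)
                                                                 (filter-filterList-comm ext S ∘ idl l) ⟩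
  sup S (λ i → filter S g (filterList f (idl l i)))  ≡⟨ filter-sup ext S (filterList-idl-ascending ext f l) ⟨
  filter S g (filter S f l)                          ∎
  where open ≡-Reasoning
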